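{- Let $T$ be a labeled plane tree, let $e$ be an edge of $T$, and let $\hat T=\phi_e(T)$. Then $e$ is improper in $T$ if and only if the corresponding edge $\hat e=(j,i)$ is proper in $\hat T$; and every edge $a\neq e$ of $T$ is improper in $T$ if and only if its corresponding edge $\hat a$ is improper in $\hat T$.
   Context: A labeled plane tree is a rooted tree whose vertices carry distinct labels from $\{1,\ldots,n+1\}$ ($n$ the number of edges) and in which the children of each vertex are linearly ordered left to right. For a vertex $j$, $\beta(j)$ is the smallest label in the subtree rooted at $j$. If $j$ has children $j_1,\ldots,j_k$ (left to right), the edge $(j,j_i)$ is improper if $\beta(j_i)<\min\{j,\beta(j_{i+1}),\ldots,\beta(j_k)\}$, and proper otherwise. The map $\phi_e$: let $e=(i,j)$ be an edge of $T$, with $i$ the parent of $j$; let $i$ have children $k_1,\ldots,k_{t-1},j,k_{t+1},\ldots,k_p$ (left to right, $j$ the $t$-th), and let $j$ have children $l_1,\ldots,l_q$. Write $\tau_v$ for the subtree rooted at $v$. Then $\phi_e(T)$ is the labeled plane tree obtained from $T$ as follows: the vertex $j$ takes the place of $i$ (it becomes the root if $i$ was the root, and otherwise becomes the child of $i$'s parent in the position previously occupied by $i$); the children of $j$ become, in order, $k_1,\ldots,k_{t-1},i,l_1,\ldots,l_q$ (with their subtrees $\tau_{k_1},\ldots,\tau_{k_{t-1}},\tau_{l_1},\ldots,\tau_{l_q}$ unchanged); and the children of $i$ become, in order, $k_{t+1},\ldots,k_p$ (with subtrees unchanged). All other parts of $T$ are unchanged. (In words: $\{i\}\cup\{\tau_{k_{t+1}},\ldots,\tau_{k_p}\}$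 and $\{j\}\cup\{\tau_{l_1},\ldots,\tau_{l_q}\}$ are swapped.) Edges of $T$ correspond to edges of $\phi_e(T)$ as follows: $e=(i,j)$ corresponds to $\hat e=(j,i)$; the edge from the parent $p$ of $i$ (if any) to $i$ corresponds to the edge $(p,j)$; each edge $(i,k_s)$ with $s<t$ corresponds to $(j,k_s)$; every other edge corresponds to itself. -}

module Defs where

open import Data.Nat using (ℕ; zero; suc; _+_; _∸_; _<_; _⊓_; _<ᵇ_; _≡ᵇ_)
open import Data.Bool using (Bool; true; false; if_then_else_)
open import Data.List using (List; []; _∷_; _++_; take; drop; length; applyUpTo; concatMap)
open import Data.Maybe using (Maybe; just; nothing)
open import Data.Product using (_×_; _,_; ∃-syntax)
open import Relation.Binary.PropositionalEquality using (_≡_)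
open import Relation.Nullary using (¬_)
open import Data.List.Relation.Binary.Permutation.Propositional using (_↭_)

data PTree : Set where
  node : ℕ → List PTree → PTree

mutual
  labels : PTree → List ℕ
  labels (node x cs) = x ∷ labelsF cs

  labelsF : List PTree → List ℕ
  labelsF [] = []
  labelsF (c ∷ cs) = labels c ++ labelsF cs

size : PTree → ℕ
size t = length (labels t)

LabeledPlaneTree : PTree → Set
LabeledPlaneTree t = labels t ↭ applyUpTo suc (size t)

mutual
  β : PTree → ℕ
  β (node x cs) = βs x cs

  βs : ℕ → List PTree → ℕ
  βs m [] = m
  βs m (t ∷ ts) = β t ⊓ βs m ts

-- Addresses of vertices: a list of 0-based child indices from the root.

Addr : Set
Addr = List ℕ

mutual
  subtree : PTree → Addr → Maybe PTree
  subtree t [] = just t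
  subtree (node x cs) (k ∷ p) = subtreeIn cs k p

  subtreeIn : List PTree → ℕ → Addr → Maybe PTree
  subtreeIn [] k p = nothing
  subtreeIn (c ∷ cs) zero p = subtree c p
  subtreeIn (c ∷ cs) (suc k) p = subtreeIn cs k p

nth : {A : Set} → List A → ℕ → Maybe A
nth [] k = nothing
nth (x ∷ xs) zero = just x
nth (x ∷ xs) (suc k) = nth xs k

-- An edge is given by the address q of its parent vertex and the
-- 0-based index k of the child among the parent's children.
Edge : Set
Edge = Addr × ℕ

IsEdge : PTree → Edge → Set
IsEdge T (q , k) = ∃[ i ] ∃[ cs ] (subtree T q ≡ just (node i cs) × k < length cs)

-- Edge (i, j_{k+1}) (children j_1..j_p of i) is improper iff
-- β(j_{k+1}) < min{ i, β(j_{k+2}), …, β(j_p) }.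
Improper : PTree → Edge → Set
Improper T (q , k) = ∃[ i ] ∃[ cs ] ∃[ c ]
  (subtree T q ≡ just (node i cs) × nth cs k ≡ just c × β c < βs i (drop (suc k) cs))

Proper : PTree → Edge → Set
Proper T (q , k) = ∃[ i ] ∃[ cs ] ∃[ c ]
  (subtree T q ≡ just (node i cs) × nth cs k ≡ just c × ¬ (β c < βs i (drop (suc k) cs)))

rotAux : ℕ → List PTree → List PTree → PTree
rotAux i before (node j ls ∷ after) = node j (before ++ node i after ∷ ls)
rotAux i before [] = node i before

rot : ℕ → PTree → PTree
rot t (node i ks) = rotAux i (take t ks) (drop t ks)

mutual
  updateAt : Addr → (PTree → PTree) → PTree → PTree
  updateAt [] f t = f t
  updateAt (k ∷ p) f (node x cs) = node x (updateIn k p f cs)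

  updateIn : ℕ → Addr → (PTree → PTree) → List PTree → List PTree
  updateIn k p f [] = []
  updateIn zero p f (c ∷ cs) = updateAt p f c ∷ cs
  updateIn (suc k) p f (c ∷ cs) = c ∷ updateIn k p f cs

φ : Edge → PTree → PTree
φ (q , t) T = updateAt q (rot t) T

-- Correspondence of edges of T with edges of φ_e(T), e = (q , t),
-- i the vertex at address q, j its child of index t.

stripPrefix : Addr → Addr → Maybe Addr
stripPrefix [] r = just r
stripPrefix (x ∷ xs) [] = nothing
stripPrefix (x ∷ xs) (y ∷ ys) = if x ≡ᵇ y then stripPrefix xs ys else nothing

-- relative part r of the parent address p = q ++ r, child index k
corrRel : Addr → ℕ → Addr → ℕ → Edge
-- parent is i: edges (i,k_s)
corrRel q t [] k =
  if k <ᵇ t then (q , k)                       -- s < t : (i,k_s) ↦ (j,k_s)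
  else if k ≡ᵇ t then (q , t)                  -- e = (i,j) ↦ ê = (j,i)
  else (q ++ t ∷ [] , k ∸ suc t)               -- s > t : (i,k_s) ↦ (i,k_s)
corrRel q t (s ∷ r) k =
  if s <ᵇ t then (q ++ s ∷ r , k)              -- inside τ_{k_s}, s < t
  else if s ≡ᵇ t then corrJ r                  -- parent j or inside τ_{l_m}
  else (q ++ t ∷ (s ∸ suc t) ∷ r , k)          -- inside τ_{k_s}, s > t
  where
  corrJ : Addr → Edge
  corrJ [] = (q , suc t + k)                   -- (j,l_m) ↦ (j,l_m)
  corrJ (m ∷ r') = (q ++ (suc t + m) ∷ r' , k) -- inside τ_{l_m}

corr : Edge → Edge → Edge
corr (q , t) (p , k) with stripPrefix q p
... | just r = corrRel q t r k
... | nothing = (p , k)   -- not below i (incl. the edge (parent of i, i))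

{-# OPTIONS --safe #-}
module Submission where

-- Whether the edge from a vertex i to its child c is improper depends only on the pair
-- (β c, min of i and the β's of the siblings right of c), here edgeβPair. The map φ_e only
-- regroups whole subtrees, so every other vertex keeps its β and, for a ≠ e, the pair of â
-- is the pair of a; the one non-obvious case is an edge (j, k_s) with s < t, whose parent
-- and right siblings cover the same labels before and after the rotation. The pair of e
-- is (β τ_j, β of i with τ_{k_{t+1}}, …, τ_{k_p}), and that of ê is the same pair swapped;
-- its entries are distinct labels, so "<" for e means "≮" for ê.

open import Defs
open import Data.Product using (_×_)
open import Relation.Binary.PropositionalEquality using (_≢_)
open import Function.Bundles using (_⇔_)

open import Data.Bool using (true; false)
open import Data.Bool.Properties using (T-≡; ¬-not)
open import Data.Empty using (⊥-elim)
open import Data.List using (List; []; _∷_; _++_; take; drop; length)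
open import Data.List.Properties using (++-assoc; ++-identityʳ; take++drop≡id)
open import Data.List.Membership.Propositional using (_∈_)
open import Data.List.Membership.Propositional.Properties using (∈-++⁺ˡ; ∈-++⁺ʳ)
import Data.List.Relation.Unary.All as All
import Data.List.Relation.Unary.All.Properties as All
open import Data.List.Relation.Unary.AllPairs using ([]; _∷_)
open import Data.List.Relation.Unary.Any using (here; there)
open import Data.List.Relation.Unary.Unique.Propositional using (Unique)
open import Data.List.Relation.Unary.Unique.Propositional.Properties using (applyUpTo⁺₁)
open import Data.List.Relation.Binary.Permutation.Propositional
  using (_↭_; ↭-sym; ↭⇒↭ₛ; module PermutationReasoning)
open import Data.List.Relation.Binary.Permutation.Propositional.Properties using (shift; ++⁺ˡ)
open import Data.Maybe using (Maybe; just; nothing; _>>=_)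
import Data.Maybe as Maybe
open import Data.Maybe.Relation.Unary.Any using (Any; just; just-equivalence)
open import Data.Nat using (ℕ; zero; suc; _+_; _<_; _≮_; _⊓_; _<ᵇ_; _≡ᵇ_; s≤s)
open import Data.Nat.Properties
  using (_≟_; ≡ᵇ⇒≡; ≡⇒≡ᵇ; <ᵇ⇒<; <⇒<ᵇ; <-cmp; <-irrefl; <⇒≢; <⇒≯; ≮⇒≥; ≤∧≢⇒<;
         ⊓-comm; ⊓-sel; suc-injective; m≤n⇒∃[o]m+o≡n; m+n∸m≡n)
open import Data.Product using (_,_; ∃-syntax; map₁; uncurry)
open import Data.Sum using (inj₁; inj₂)
open import Function using (_∘_)
open import Function.Bundles using (mk⇔; Equivalence)
open import Function.Properties.Equivalence using (⇔-setoid)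
open import Level using (0ℓ)
open import Relation.Binary.Definitions using (tri<; tri≈; tri>)
import Relation.Binary.PropositionalEquality as ≡
open import Relation.Binary.PropositionalEquality using (_≡_; refl; sym; trans; cong; module ≡-Reasoning)
import Relation.Binary.Reasoning.Setoid (⇔-setoid 0ℓ) as ⇔-Reasoning
open import Data.List.Relation.Binary.Permutation.Setoid.Properties (≡.setoid ℕ) using (Unique-resp-↭)
open import Relation.Nullary using (yes; no)

≡ᵇ-refl : ∀ m → (m ≡ᵇ m) ≡ true
≡ᵇ-refl m = Equivalence.to T-≡ (≡⇒≡ᵇ m m refl)

≢⇒≡ᵇ≡false : ∀ {m n} → m ≢ n → (m ≡ᵇ n) ≡ false
≢⇒≡ᵇ≡false {m} {n} m≢n = ¬-not {y = true} (m≢n ∘ ≡ᵇ⇒≡ m n ∘ Equivalence.from T-≡)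

<⇒<ᵇ≡true : ∀ {m n} → m < n → (m <ᵇ n) ≡ true
<⇒<ᵇ≡true = Equivalence.to T-≡ ∘ <⇒<ᵇ

≮⇒<ᵇ≡false : ∀ {m n} → m ≮ n → (m <ᵇ n) ≡ false
≮⇒<ᵇ≡false {m} {n} m≮n = ¬-not {y = true} (m≮n ∘ <ᵇ⇒< m n ∘ Equivalence.from T-≡)

module _ {A : Set} where

  take-length-++ : ∀ (xs ys : List A) → take (length xs) (xs ++ ys) ≡ xs
  take-length-++ []       ys = refl
  take-length-++ (x ∷ xs) ys = cong (x ∷_) (take-length-++ xs ys)

  drop-length-++ : ∀ (xs ys : List A) → drop (length xs) (xs ++ ys) ≡ ys
  drop-length-++ []       ys = refl
  drop-length-++ (x ∷ xs) ys = drop-length-++ xs ys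

  split-at : ∀ (xs : List A) t → t < length xs →
             ∃[ ys ] ∃[ x ] ∃[ zs ] (xs ≡ ys ++ x ∷ zs × length ys ≡ t)
  split-at (x ∷ xs) zero    _         = [] , x , xs , refl , refl
  split-at (x ∷ xs) (suc t) (s≤s t<n) with split-at xs t t<n
  ... | ys , y , zs , refl , refl = x ∷ ys , y , zs , refl , refl

  Unique-++⁻ˡ : ∀ (xs : List A) {ys} → Unique (xs ++ ys) → Unique xs
  Unique-++⁻ˡ []       _          = []
  Unique-++⁻ˡ (x ∷ xs) (x∉ ∷ u) = All.++⁻ˡ xs x∉ ∷ Unique-++⁻ˡ xs u

  Unique-++⁻ʳ : ∀ (xs : List A) {ys} → Unique (xs ++ ys) → Unique ys
  Unique-++⁻ʳ []       u       = u
  Unique-++⁻ʳ (x ∷ xs) (_ ∷ u) = Unique-++⁻ʳ xs u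

  Unique-++⇒≢ : ∀ (xs : List A) {ys x y} → Unique (xs ++ ys) → x ∈ xs → y ∈ ys → x ≢ y
  Unique-++⇒≢ (x ∷ xs) (x∉ ∷ _) (here refl) y∈ = All.lookup (All.++⁻ʳ xs x∉) y∈
  Unique-++⇒≢ (x ∷ xs) (_ ∷ u)  (there x∈)  y∈ = Unique-++⇒≢ xs u x∈ y∈

labelsF-++ : ∀ xs ys → labelsF (xs ++ ys) ≡ labelsF xs ++ labelsF ys
labelsF-++ []       ys = refl
labelsF-++ (x ∷ xs) ys =
  trans (cong (labels x ++_) (labelsF-++ xs ys)) (sym (++-assoc (labels x) (labelsF xs) (labelsF ys)))

labels-split : ∀ i B c A → labels (node i (B ++ c ∷ A)) ↭ labelsF B ++ labels c ++ labels (node i A)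
labels-split i B c A = begin
  i ∷ labelsF (B ++ c ∷ A)                ≡⟨ cong (i ∷_) (labelsF-++ B (c ∷ A)) ⟩
  i ∷ labelsF B ++ labels c ++ labelsF A  ↭⟨ shift i (labelsF B) _ ⟨
  labelsF B ++ i ∷ labels c ++ labelsF A  ↭⟨ ++⁺ˡ (labelsF B) (↭-sym (shift i (labels c) (labelsF A))) ⟩
  labelsF B ++ labels c ++ i ∷ labelsF A  ∎
  where open PermutationReasoning

mutual
  β∈labels : ∀ T → β T ∈ labels T
  β∈labels (node m ts) = βs∈labels m ts

  βs∈labels : ∀ m ts → βs m ts ∈ m ∷ labelsF ts
  βs∈labels m []       = here refl
  βs∈labels m (t ∷ ts) with ⊓-sel (β t) (βs m ts)
  ... | inj₁ eq rewrite eq = there (∈-++⁺ˡ (β∈labels t))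
  ... | inj₂ eq rewrite eq with βs∈labels m ts
  ...   | here  m≡    = here m≡
  ...   | there ∈ts   = there (∈-++⁺ʳ (labels t) ∈ts)

LabeledPlaneTree⇒Unique : ∀ T → LabeledPlaneTree T → Unique (labels T)
LabeledPlaneTree⇒Unique T lpt =
  Unique-resp-↭ (↭⇒↭ₛ (↭-sym lpt)) (applyUpTo⁺₁ suc (size T) (λ i<j _ → <⇒≢ i<j ∘ suc-injective))

mutual
  Unique-subtree : ∀ q T {S} → Unique (labels T) → subtree T q ≡ just S → Unique (labels S)
  Unique-subtree []      T           u       refl = u
  Unique-subtree (x ∷ q) (node y cs) (_ ∷ u) T[q] = Unique-subtreeIn x q cs u T[q]

  Unique-subtreeIn : ∀ x q cs {S} → Unique (labelsF cs) → subtreeIn cs x q ≡ just S → Unique (labels S)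
  Unique-subtreeIn zero    q (c ∷ cs) u cs[x,q] = Unique-subtree q c (Unique-++⁻ˡ (labels c) u) cs[x,q]
  Unique-subtreeIn (suc x) q (c ∷ cs) u cs[x,q] =
    Unique-subtreeIn x q cs (Unique-++⁻ʳ (labels c) u) cs[x,q]

β-distinct : ∀ i B c A → Unique (labels (node i (B ++ c ∷ A))) → β c ≢ β (node i A)
β-distinct i B c A u = Unique-++⇒≢ (labels c)
  (Unique-++⁻ʳ (labelsF B) (Unique-resp-↭ (↭⇒↭ₛ (labels-split i B c A)) u))
  (β∈labels c) (β∈labels (node i A))

β-++-cong : ∀ B {i X j Y} → β (node i X) ≡ β (node j Y) → β (node i (B ++ X)) ≡ β (node j (B ++ Y))
β-++-cong []      eq = eq
β-++-cong (b ∷ B) eq = cong (β b ⊓_) (β-++-cong B eq)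

β-exchange : ∀ i B j ls A → β (node j (B ++ node i A ∷ ls)) ≡ β (node i (B ++ node j ls ∷ A))
β-exchange i B j ls A = β-++-cong B (⊓-comm (βs i A) (βs j ls))

rot-length : ∀ i B j ls A → rot (length B) (node i (B ++ node j ls ∷ A)) ≡ node j (B ++ node i A ∷ ls)
rot-length i B j ls A
  rewrite take-length-++ B (node j ls ∷ A) | drop-length-++ B (node j ls ∷ A) = refl

β-rotAux : ∀ i before rest → β (rotAux i before rest) ≡ β (node i (before ++ rest))
β-rotAux i before []                  = cong (βs i) (sym (++-identityʳ before))
β-rotAux i before (node j ls ∷ after) = β-exchange i before j ls after

β-rot : ∀ t S → β (rot t S) ≡ β S
β-rot t (node i cs) = trans (β-rotAux i (take t cs) (drop t cs)) (cong (βs i) (take++drop≡id t cs))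

childβPair : ℕ → PTree → Maybe (ℕ × ℕ)
childβPair k (node i cs) = Maybe.map (λ c → β c , βs i (drop (suc k) cs)) (nth cs k)

edgeβPair : PTree → Edge → Maybe (ℕ × ℕ)
edgeβPair T (q , k) = subtree T q >>= childβPair k

-- Improper is EdgeRel _<_ and Proper is EdgeRel _≮_, definitionally.
EdgeRel : (ℕ → ℕ → Set) → PTree → Edge → Set
EdgeRel R T (q , k) = ∃[ i ] ∃[ cs ] ∃[ c ]
  (subtree T q ≡ just (node i cs) × nth cs k ≡ just c × R (β c) (βs i (drop (suc k) cs)))

EdgeRel⇔edgeβPair : ∀ R T a → EdgeRel R T a ⇔ Any (uncurry R) (edgeβPair T a)
EdgeRel⇔edgeβPair R T (q , k) = mk⇔ to from
  where
  to : EdgeRel R T (q , k) → Any (uncurry R) (edgeβPair T (q , k))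
  to (i , cs , c , T[q] , cs[k] , rel) rewrite T[q] | cs[k] = just rel
  from : Any (uncurry R) (edgeβPair T (q , k)) → EdgeRel R T (q , k)
  from rel with subtree T q in T[q]
  ... | just (node i cs) with nth cs k in cs[k]
  ...   | just c with just r ← rel = i , cs , c , refl , cs[k] , r

EdgeRel-resp-edgeβPair : ∀ R T a T′ a′ → edgeβPair T a ≡ edgeβPair T′ a′ →
                         EdgeRel R T a ⇔ EdgeRel R T′ a′
EdgeRel-resp-edgeβPair R T a T′ a′ eq = begin
  EdgeRel R T a                      ≈⟨ EdgeRel⇔edgeβPair R T a ⟩
  Any (uncurry R) (edgeβPair T a)    ≡⟨ cong (Any (uncurry R)) eq ⟩
  Any (uncurry R) (edgeβPair T′ a′)  ≈⟨ EdgeRel⇔edgeβPair R T′ a′ ⟨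
  EdgeRel R T′ a′                    ∎
  where open ⇔-Reasoning

Improper⇔Proper-swap : ∀ T a T′ a′ {x y} → edgeβPair T a ≡ just (x , y) →
                       edgeβPair T′ a′ ≡ just (y , x) → x ≢ y → Improper T a ⇔ Proper T′ a′
Improper⇔Proper-swap T a T′ a′ {x} {y} T[a] T′[a′] x≢y = begin
  Improper T a                         ≈⟨ EdgeRel⇔edgeβPair _<_ T a ⟩
  Any (uncurry _<_) (edgeβPair T a)    ≡⟨ cong (Any (uncurry _<_)) T[a] ⟩
  Any (uncurry _<_) (just (x , y))     ≈⟨ just-equivalence ⟨
  x < y                                ≈⟨ mk⇔ <⇒≯ (λ y≮x → ≤∧≢⇒< (≮⇒≥ y≮x) x≢y) ⟩
  y ≮ x                                ≈⟨ just-equivalence ⟩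
  Any (uncurry _≮_) (just (y , x))     ≡⟨ cong (Any (uncurry _≮_)) T′[a′] ⟨
  Any (uncurry _≮_) (edgeβPair T′ a′)  ≈⟨ EdgeRel⇔edgeβPair _≮_ T′ a′ ⟨
  Proper T′ a′                         ∎
  where open ⇔-Reasoning

childβPair-++ˡ : ∀ B {i X j Y k} → k < length B → β (node i X) ≡ β (node j Y) →
                 childβPair k (node i (B ++ X)) ≡ childβPair k (node j (B ++ Y))
childβPair-++ˡ (b ∷ B) {k = zero}  _         eq = cong (λ m → just (β b , m)) (β-++-cong B eq)
childβPair-++ˡ (b ∷ B) {k = suc k} (s≤s k<B) eq = childβPair-++ˡ B k<B eq

childβPair-++-length : ∀ B {i c A} →
                       childβPair (length B) (node i (B ++ c ∷ A)) ≡ just (β c , β (node i A))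
childβPair-++-length []      = refl
childβPair-++-length (b ∷ B) = childβPair-++-length B

childβPair-++-∷ : ∀ B {i c A} k →
                  childβPair (suc (length B + k)) (node i (B ++ c ∷ A)) ≡ childβPair k (node i A)
childβPair-++-∷ []      k = refl
childβPair-++-∷ (b ∷ B) k = childβPair-++-∷ B k

subtreeIn-++ˡ : ∀ B {X s} r → s < length B → subtreeIn (B ++ X) s r ≡ subtreeIn B s r
subtreeIn-++ˡ (b ∷ B) {s = zero}  r _         = refl
subtreeIn-++ˡ (b ∷ B) {s = suc s} r (s≤s s<B) = subtreeIn-++ˡ B r s<B

subtreeIn-++-length : ∀ B {c A} r → subtreeIn (B ++ c ∷ A) (length B) r ≡ subtree c r
subtreeIn-++-length []      r = refl
subtreeIn-++-length (b ∷ B) r = subtreeIn-++-length B r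

subtreeIn-++-∷ : ∀ B {c A} s r → subtreeIn (B ++ c ∷ A) (suc (length B + s)) r ≡ subtreeIn A s r
subtreeIn-++-∷ []      s r = refl
subtreeIn-++-∷ (b ∷ B) s r = subtreeIn-++-∷ B s r

mutual
  subtree-++ : ∀ q p T {S} → subtree T q ≡ just S → subtree T (q ++ p) ≡ subtree S p
  subtree-++ []      p T           refl = refl
  subtree-++ (x ∷ q) p (node y cs) T[q] = subtreeIn-++ x q p cs T[q]

  subtreeIn-++ : ∀ x q p cs {S} → subtreeIn cs x q ≡ just S → subtreeIn cs x (q ++ p) ≡ subtree S p
  subtreeIn-++ zero    q p (c ∷ cs) cs[x,q] = subtree-++ q p c cs[x,q]
  subtreeIn-++ (suc x) q p (c ∷ cs) cs[x,q] = subtreeIn-++ x q p cs cs[x,q]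

edgeβPair-++ : ∀ q {p k} T {S} → subtree T q ≡ just S → edgeβPair T (q ++ p , k) ≡ edgeβPair S (p , k)
edgeβPair-++ q {p} {k} T T[q] = cong (_>>= childβPair k) (subtree-++ q p T T[q])

module _ {f : PTree → PTree} where

  mutual
    subtree-updateAt : ∀ q T {S} → subtree T q ≡ just S → subtree (updateAt q f T) q ≡ just (f S)
    subtree-updateAt []      T           refl = refl
    subtree-updateAt (x ∷ q) (node y cs) T[q] = subtreeIn-updateIn x q cs T[q]

    subtreeIn-updateIn : ∀ x q cs {S} → subtreeIn cs x q ≡ just S →
                         subtreeIn (updateIn x q f cs) x q ≡ just (f S)
    subtreeIn-updateIn zero    q (c ∷ cs) cs[x,q] = subtree-updateAt q c cs[x,q]
    subtreeIn-updateIn (suc x) q (c ∷ cs) cs[x,q] = subtreeIn-updateIn x q cs cs[x,q]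

  subtreeIn-updateIn-≢ : ∀ x q cs y p → x ≢ y → subtreeIn (updateIn x q f cs) y p ≡ subtreeIn cs y p
  subtreeIn-updateIn-≢ x       q []       y       p x≢y = refl
  subtreeIn-updateIn-≢ zero    q (c ∷ cs) zero    p x≢y = ⊥-elim (x≢y refl)
  subtreeIn-updateIn-≢ zero    q (c ∷ cs) (suc y) p x≢y = refl
  subtreeIn-updateIn-≢ (suc x) q (c ∷ cs) zero    p x≢y = refl
  subtreeIn-updateIn-≢ (suc x) q (c ∷ cs) (suc y) p x≢y =
    subtreeIn-updateIn-≢ x q cs y p (x≢y ∘ cong suc)

stripPrefix-∷ : ∀ x q p → stripPrefix (x ∷ q) (x ∷ p) ≡ stripPrefix q p
stripPrefix-∷ x q p rewrite ≡ᵇ-refl x = refl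

stripPrefix-refl : ∀ q → stripPrefix q q ≡ just []
stripPrefix-refl []      = refl
stripPrefix-refl (x ∷ q) = trans (stripPrefix-∷ x q q) (stripPrefix-refl q)

stripPrefix-just : ∀ q p {r} → stripPrefix q p ≡ just r → p ≡ q ++ r
stripPrefix-just []      p       refl = refl
stripPrefix-just (x ∷ q) (y ∷ p) eq with x ≟ y
... | yes refl = cong (x ∷_) (stripPrefix-just q p (trans (sym (stripPrefix-∷ x q p)) eq))
... | no  x≢y rewrite ≢⇒≡ᵇ≡false x≢y with () ← eq

corrRel-prefix : ∀ q t r k → corrRel q t r k ≡ map₁ (q ++_) (corrRel [] t r k)
corrRel-prefix q t [] k with k <ᵇ t | k ≡ᵇ t
... | true  | _     = cong (_, k) (sym (++-identityʳ q))
... | false | true  = cong (_, t) (sym (++-identityʳ q))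
... | false | false = refl
corrRel-prefix q t (s ∷ r) k with s <ᵇ t | s ≡ᵇ t
... | true  | _     = refl
... | false | false = refl
corrRel-prefix q t (s ∷ [])     k | false | true = cong (_, suc t + k) (sym (++-identityʳ q))
corrRel-prefix q t (s ∷ m ∷ r) k | false | true = refl

corr-self : ∀ q t → corr (q , t) (q , t) ≡ (q , t)
corr-self q t rewrite stripPrefix-refl q | ≮⇒<ᵇ≡false (<-irrefl {t} refl) | ≡ᵇ-refl t = refl

module _ {f : PTree → PTree} (f-β : ∀ S → β (f S) ≡ β S) where

  mutual
    β-updateAt : ∀ q T → β (updateAt q f T) ≡ β T
    β-updateAt []      T           = f-β T
    β-updateAt (x ∷ q) (node y cs) = βs-updateIn y x q cs

    βs-updateIn : ∀ m x q cs → βs m (updateIn x q f cs) ≡ βs m cs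
    βs-updateIn m x       q []       = refl
    βs-updateIn m zero    q (c ∷ cs) = cong (_⊓ βs m cs) (β-updateAt q c)
    βs-updateIn m (suc x) q (c ∷ cs) = cong (β c ⊓_) (βs-updateIn m x q cs)

  childβPair-updateIn : ∀ k y x q cs →
                        childβPair k (node y (updateIn x q f cs)) ≡ childβPair k (node y cs)
  childβPair-updateIn k       y x       q []       = refl
  childβPair-updateIn zero    y zero    q (c ∷ cs) = cong (λ b → just (b , βs y cs)) (β-updateAt q c)
  childβPair-updateIn (suc k) y zero    q (c ∷ cs) = refl
  childβPair-updateIn zero    y (suc x) q (c ∷ cs) = cong (λ m → just (β c , m)) (βs-updateIn y x q cs)
  childβPair-updateIn (suc k) y (suc x) q (c ∷ cs) = childβPair-updateIn k y x q cs

  mutual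
    edgeβPair-updateAt-off : ∀ q p k T → stripPrefix q p ≡ nothing →
                             edgeβPair (updateAt q f T) (p , k) ≡ edgeβPair T (p , k)
    edgeβPair-updateAt-off []      p        k T           ()
    edgeβPair-updateAt-off (x ∷ q) []       k (node y cs) _   = childβPair-updateIn k y x q cs
    edgeβPair-updateAt-off (x ∷ q) (x′ ∷ p) k (node y cs) off with x ≟ x′
    ... | yes refl = edgeβPairIn-updateIn-off x q p k cs (trans (sym (stripPrefix-∷ x q p)) off)
    ... | no  x≢x′ = cong (_>>= childβPair k) (subtreeIn-updateIn-≢ x q cs x′ p x≢x′)

    edgeβPairIn-updateIn-off : ∀ x q p k cs → stripPrefix q p ≡ nothing →
      (subtreeIn (updateIn x q f cs) x p >>= childβPair k) ≡ (subtreeIn cs x p >>= childβPair k)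
    edgeβPairIn-updateIn-off x       q p k []       off = refl
    edgeβPairIn-updateIn-off zero    q p k (c ∷ cs) off = edgeβPair-updateAt-off q p k c off
    edgeβPairIn-updateIn-off (suc x) q p k (c ∷ cs) off = edgeβPairIn-updateIn-off x q p k cs off

edgeβPair-rot-τj : ∀ i B j ls A r k →
  edgeβPair (node j (B ++ node i A ∷ ls)) (corrRel [] (length B) (length B ∷ r) k) ≡
  edgeβPair (node j ls) (r , k)
edgeβPair-rot-τj i B j ls A r k
  rewrite ≮⇒<ᵇ≡false (<-irrefl {length B} refl) | ≡ᵇ-refl (length B) with r
... | []     = childβPair-++-∷ B k
... | m ∷ r′ = cong (_>>= childβPair k) (subtreeIn-++-∷ B m r′)

edgeβPair-rot : ∀ i B j ls A r k → (r , k) ≢ ([] , length B) →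
  edgeβPair (node j (B ++ node i A ∷ ls)) (corrRel [] (length B) r k) ≡
  edgeβPair (node i (B ++ node j ls ∷ A)) (r , k)
edgeβPair-rot i B j ls A [] k r,k≢e with <-cmp k (length B)
... | tri< k<t _ _ rewrite <⇒<ᵇ≡true k<t = childβPair-++ˡ B k<t (β-exchange i [] j ls A)
... | tri≈ _ refl _ = ⊥-elim (r,k≢e refl)
... | tri> k≮t k≢t t<k with m≤n⇒∃[o]m+o≡n t<k
...   | o , refl rewrite ≮⇒<ᵇ≡false k≮t | ≢⇒≡ᵇ≡false k≢t | m+n∸m≡n (length B) o
                       | subtreeIn-++-length B {node i A} {ls} [] = sym (childβPair-++-∷ B o)
edgeβPair-rot i B j ls A (s ∷ r) k _ with <-cmp s (length B)
... | tri< s<t _ _ rewrite <⇒<ᵇ≡true s<t | subtreeIn-++ˡ B {node i A ∷ ls} r s<t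
                         | subtreeIn-++ˡ B {node j ls ∷ A} r s<t = refl
... | tri≈ _ refl _ rewrite subtreeIn-++-length B {node j ls} {A} r = edgeβPair-rot-τj i B j ls A r k
... | tri> s≮t s≢t t<s with m≤n⇒∃[o]m+o≡n t<s
...   | o , refl rewrite ≮⇒<ᵇ≡false s≮t | ≢⇒≡ᵇ≡false s≢t | m+n∸m≡n (length B) o
                       | subtreeIn-++-length B {node i A} {ls} (o ∷ r)
                       | subtreeIn-++-∷ B {node j ls} {A} o r = refl

edgeβPair-φ : ∀ T q t → IsEdge T (q , t) → ∀ p k → (p , k) ≢ (q , t) →
              edgeβPair (φ (q , t) T) (corr (q , t) (p , k)) ≡ edgeβPair T (p , k)
edgeβPair-φ T q t (i , cs , T[q] , t<cs) p k a≢e with stripPrefix q p in q⊑p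
... | nothing = edgeβPair-updateAt-off (β-rot t) q p k T q⊑p
... | just r with split-at cs t t<cs | stripPrefix-just q p q⊑p
...   | B , node j ls , A , refl , refl | refl rewrite corrRel-prefix q (length B) r k = begin
  edgeβPair (updateAt q (rot (length B)) T) (map₁ (q ++_) â)
    ≡⟨ edgeβPair-++ q _ (subtree-updateAt q T T[q]) ⟩
  edgeβPair (rot (length B) (node i (B ++ node j ls ∷ A))) â
    ≡⟨ cong (λ S → edgeβPair S â) (rot-length i B j ls A) ⟩
  edgeβPair (node j (B ++ node i A ∷ ls)) â
    ≡⟨ edgeβPair-rot i B j ls A r k r,k≢e ⟩
  edgeβPair (node i (B ++ node j ls ∷ A)) (r , k)
    ≡⟨ edgeβPair-++ q T T[q] ⟨
  edgeβPair T (q ++ r , k)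
    ∎
  where
  open ≡-Reasoning
  â = corrRel [] (length B) r k
  r,k≢e : (r , k) ≢ ([] , length B)
  r,k≢e refl = a≢e (cong (_, length B) (++-identityʳ q))

edgeβPair-self : ∀ T q {i B j ls A} → subtree T q ≡ just (node i (B ++ node j ls ∷ A)) →
                 edgeβPair T (q , length B) ≡ just (β (node j ls) , β (node i A))
edgeβPair-self T q {B = B} T[q] rewrite T[q] = childβPair-++-length B

edgeβPair-φ-self : ∀ T q {i B j ls A} → subtree T q ≡ just (node i (B ++ node j ls ∷ A)) →
                   edgeβPair (φ (q , length B) T) (q , length B) ≡ just (β (node i A) , β (node j ls))
edgeβPair-φ-self T q {i} {B} {j} {ls} {A} T[q]
  rewrite subtree-updateAt {rot (length B)} q T T[q] | rot-length i B j ls A = childβPair-++-length B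

proposition2p1 : (T : PTree) → LabeledPlaneTree T → (e : Edge) → IsEdge T e →
    (Improper T e ⇔ Proper (φ e T) (corr e e)) ×
    ((a : Edge) → IsEdge T a → a ≢ e → (Improper T a ⇔ Improper (φ e T) (corr e a)))
proposition2p1 T lpt (q , t) e@(i , cs , T[q] , t<cs) with split-at cs t t<cs
... | B , node j ls , A , refl , refl rewrite corr-self q (length B) =
  Improper⇔Proper-swap T e′ (φ e′ T) e′ (edgeβPair-self T q T[q]) (edgeβPair-φ-self T q T[q])
    (β-distinct i B (node j ls) A (Unique-subtree q T (LabeledPlaneTree⇒Unique T lpt) T[q])) ,
  λ (p , k) _ a≢e → EdgeRel-resp-edgeβPair _<_ T (p , k) (φ e′ T) (corr e′ (p , k))
                      (sym (edgeβPair-φ T q (length B) e p k a≢e))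
  where e′ = (q , length B)
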